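{- Let $\mathcal{M}$ be a labeling of a finite atomic lattice $P$. If there is a variable $x_0$ such that, for all $p,q\in P$, $x_0\mid m_p$ and $x_0\mid m_q$ imply that $p$ and $q$ are comparable, then $x_0\nmid \dfrac{x(a)}{\gcd(\triangle(a),x(a))}$ for every atom $a$ of $P$.
   Context: A finite atomic lattice is a finite lattice $P$ with least element $0$ and greatest element in which every nonzero element is a join of atoms; $\mathrm{atoms}(P)$ is its set of atoms, and $\mathrm{supp}(p)=\{a\in\mathrm{atoms}(P): a\le p\}$. For $p\in P$, $\lceil p\rceil=\{q: q\ge p\}$ and $\lceil p\rceil^c=P\setminus\lceil p\rceil$. A labeling $\mathcal{M}$ of $P$ assigns a monomial $m_p$ (in a polynomial ring over a field) to each $p\in P$, unlabeled elements having label $1$. Conventions: $\mathrm{lcm}\,\emptyset=\gcd\emptyset=1$. For $a\in\mathrm{atoms}(P)$ let $x(a)=\prod_{p\in\lceil a\rceil^c}m_p$. For $p\in P$ let $B_p=\{T\subseteq\mathrm{supp}(p): \bigvee_{b\in T}b=p\}$, and for $a\in\mathrm{atoms}(P)$ let $\triangle(a)=\gcd\{\mathrm{lcm}\{x(b):b\in T\}: T\in\bigcup_{q\ge a}B_q\}$. -}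

module Defs where

open import Data.Nat using (ℕ; zero; suc; _+_; _∸_; _⊔_; _⊓_; _≤_)
open import Data.Fin using (Fin)
open import Data.Fin.Properties using (all?)
open import Data.Bool using (Bool; true; false; if_then_else_)
open import Data.Vec using (Vec; []; _∷_; lookup)
open import Data.List using (List; []; _∷_; _++_; map; foldr; filter; concatMap; allFin)
open import Data.Sum using (_⊎_)
open import Data.Product using (_×_; ∃)
open import Relation.Nullary using (¬_; Dec; yes; no)
open import Relation.Nullary.Decidable using (_⊎-dec_; _×-dec_; ¬?)
open import Relation.Unary using (Pred)
open import Relation.Binary using (Decidable)
open import Relation.Binary.PropositionalEquality using (_≡_; _≢_)
open import Relation.Binary.Lattice.Structures using (IsLattice)
import Data.Fin.Properties as FinP

-- Monomials in k variables x_0 … x_{k-1}, as exponent vectors.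

Monomial : ℕ → Set
Monomial k = Fin k → ℕ

one : ∀ {k} → Monomial k
one _ = 0

_·_ : ∀ {k} → Monomial k → Monomial k → Monomial k
(m · m') i = m i + m' i

lcm₂ : ∀ {k} → Monomial k → Monomial k → Monomial k
lcm₂ m m' i = m i ⊔ m' i

gcd₂ : ∀ {k} → Monomial k → Monomial k → Monomial k
gcd₂ m m' i = m i ⊓ m' i

-- exact quotient m / d (used only when d divides m)
_÷_ : ∀ {k} → Monomial k → Monomial k → Monomial k
(m ÷ d) i = m i ∸ d i

prod : ∀ {k} → List (Monomial k) → Monomial k
prod = foldr _·_ one

lcmL : ∀ {k} → List (Monomial k) → Monomial k
lcmL = foldr lcm₂ one

gcdL : ∀ {k} → List (Monomial k) → Monomial k
gcdL [] = one
gcdL (m ∷ []) = m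
gcdL (m ∷ ms@(_ ∷ _)) = gcd₂ m (gcdL ms)

VarDivides : ∀ {k} → Fin k → Monomial k → Set
VarDivides i m = 1 ≤ m i

record FiniteLattice : Set₁ where
  field
    size      : ℕ
    _≼_       : Fin size → Fin size → Set
    _≼?_      : Decidable _≼_
    _∨_       : Fin size → Fin size → Fin size
    _∧_       : Fin size → Fin size → Fin size
    isLattice : IsLattice _≡_ _≼_ _∨_ _∧_
    𝟘 𝟙       : Fin size
    𝟘-least   : ∀ p → 𝟘 ≼ p
    𝟙-great   : ∀ p → p ≼ 𝟙

  Elt : Set
  Elt = Fin size

  IsAtom : Elt → Set
  IsAtom a = a ≢ 𝟘 × (∀ p → p ≼ a → p ≡ 𝟘 ⊎ p ≡ a)

  isAtom? : (a : Elt) → Dec (IsAtom a)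
  isAtom? a = ¬? (a FinP.≟ 𝟘) ×-dec
              all? (λ p → ¬? (p ≼? a) ⊎-dec' ((p FinP.≟ 𝟘) ⊎-dec (p FinP.≟ a)))
    where
    _⊎-dec'_ : ∀ {A B : Set} → Dec (¬ A) → Dec B → Dec (A → B)
    _⊎-dec'_ {A} {B} (yes ¬a) _ = yes λ x → Data.Empty.⊥-elim (¬a x)
      where import Data.Empty
    (no ¬¬a) ⊎-dec' (yes b) = yes λ _ → b
    _⊎-dec'_ {A} {B} (no ¬¬a) (no ¬b) = no λ f → ¬¬a λ x → ¬b (f x)

  Subset : Set
  Subset = Vec Bool size

  _∈ₛ_ : Elt → Subset → Set
  p ∈ₛ T = lookup T p ≡ true

  ⋁ : Subset → Elt
  ⋁ T = foldr (λ i acc → if lookup T i then i ∨ acc else acc) 𝟘 (allFin size)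

  IsAtomic : Set
  IsAtomic = ∀ p → p ≢ 𝟘 → ∃ λ (T : Subset) → (∀ b → b ∈ₛ T → IsAtom b) × ⋁ T ≡ p

allSubsets : ∀ n → List (Vec Bool n)
allSubsets zero = [] ∷ []
allSubsets (suc n) = map (true ∷_) (allSubsets n) ++ map (false ∷_) (allSubsets n)

record FiniteAtomicLattice : Set₁ where
  field
    lattice  : FiniteLattice
  open FiniteLattice lattice public
  field
    atomic   : IsAtomic

  atoms : List Elt
  atoms = filter isAtom? (allFin size)

  Supp : Elt → Elt → Set
  Supp p a = IsAtom a × a ≼ p

  InB : Elt → Subset → Set
  InB p T = (∀ b → b ∈ₛ T → Supp p b) × ⋁ T ≡ p

  inB? : (p : Elt) → (T : Subset) → Dec (InB p T)
  inB? p T = all? (λ b → imp (lookup T b Data.Bool.≟ true) (isAtom? b ×-dec (b ≼? p)))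
             ×-dec (⋁ T FinP.≟ p)
    where
    import Data.Bool
    imp : ∀ {A B : Set} → Dec A → Dec B → Dec (A → B)
    imp (no ¬a) _ = yes λ x → Data.Empty.⊥-elim (¬a x)
      where import Data.Empty
    imp (yes a) (yes b) = yes λ _ → b
    imp (yes a) (no ¬b) = no λ f → ¬b (f a)

  members : Subset → List Elt
  members T = filter (λ i → lookup T i Data.Bool.≟ true) (allFin size)
    where import Data.Bool

  upperB : Elt → List Subset
  upperB a = concatMap (λ q → filter (inB? q) (allSubsets size))
                       (filter (a ≼?_) (allFin size))

Labeling : FiniteAtomicLattice → ℕ → Set
Labeling P k = FiniteAtomicLattice.Elt P → Monomial k

module _ (P : FiniteAtomicLattice) {k : ℕ} (m : Labeling P k) where
  open FiniteAtomicLattice P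

  xLab : Elt → Monomial k
  xLab a = prod (map m (filter (λ p → ¬? (a ≼? p)) (allFin size)))

  triangle : Elt → Monomial k
  triangle a = gcdL (map (λ T → lcmL (map xLab (members T))) (upperB a))

-- Marked elements (those whose label is divisible by x₀) form a chain, so those outside ⌈a⌉
-- either do not exist, and then x₀ ∤ x(a), or have a largest element c with a ⋠ c.  Every
-- T ∈ B_q with q ≥ a contains some b ⋠ c, since otherwise q = ⋁ T ≤ c; every marked p ⋡ a
-- lies below c, hence p ⋡ b.  So the x₀-exponent of x(a) is at most that of x(b), and hence
-- at most that of lcm {x(b) : b ∈ T} for every such T, i.e. of △(a).  The quotient
-- x(a) / gcd(△(a), x(a)) therefore has x₀-exponent 0.
module Submission where

open import Defs
open import Level using (Level)
open import Data.Nat using (ℕ; _+_; _≤_; _∸_; _⊓_; z≤n; _≤?_)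
open import Data.Nat.Properties
  using (≤-trans; +-monoʳ-≤; m≤n+m; ⊓-glb; m≤m⊔n; m≤n⊔m; m≥n⇒m⊓n≡n; n∸n≡0; n<1⇒n≡0; ≰⇒>)
open import Data.Fin using (Fin)
open import Data.Sum using (_⊎_; inj₁; inj₂)
open import Data.Product using (_×_; _,_; proj₁; proj₂; ∃-syntax; ∄-syntax)
open import Data.Bool using (Bool; true; false; if_then_else_; _≟_)
open import Data.Vec using (Vec; []; _∷_; lookup)
open import Data.List using (List; []; _∷_; map; foldr; filter; allFin)
open import Data.List.Membership.Propositional using (_∈_; find; lose)
open import Data.List.Membership.Propositional.Properties
  using (∈-allFin; ∈-map⁺; ∈-map⁻; ∈-filter⁺; ∈-filter⁻; ∈-concatMap⁺; ∈-concatMap⁻; ∈-++⁺ˡ; ∈-++⁺ʳ)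
open import Data.List.Relation.Unary.Any using (here; there)
open import Data.Empty using (⊥-elim)
open import Function using (_∘_)
open import Relation.Nullary using (¬_; yes; no)
open import Relation.Nullary.Decidable using (_×-dec_; ¬?)
open import Relation.Unary using (Pred) renaming (Decidable to Decidable₁)
open import Relation.Binary using (Rel; Reflexive; Transitive)
open import Relation.Binary.PropositionalEquality using (_≡_; _≢_; refl; sym; trans; cong; cong₂; subst)
open import Relation.Binary.Lattice.Structures using (IsLattice)

n≤m⇒n∸m⊓n≡0 : ∀ {m n} → n ≤ m → n ∸ (m ⊓ n) ≡ 0
n≤m⇒n∸m⊓n≡0 {n = n} n≤m = trans (cong (n ∸_) (m≥n⇒m⊓n≡n n≤m)) (n∸n≡0 n)

module _ {a : Level} {A : Set a} {k : ℕ} (f : A → Monomial k) (i : Fin k) where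

  prod-filter-mono : ∀ {p q} {P : Pred A p} {Q : Pred A q} (P? : Decidable₁ P) (Q? : Decidable₁ Q) →
    (∀ x → VarDivides i (f x) → P x → Q x) →
    ∀ xs → prod (map f (filter P? xs)) i ≤ prod (map f (filter Q? xs)) i
  prod-filter-mono P? Q? P⇒Q [] = z≤n
  prod-filter-mono P? Q? P⇒Q (x ∷ xs) with P? x | Q? x
  ... | yes _ | yes _ = +-monoʳ-≤ (f x i) (prod-filter-mono P? Q? P⇒Q xs)
  ... | no _  | no _  = prod-filter-mono P? Q? P⇒Q xs
  ... | no _  | yes _ = ≤-trans (prod-filter-mono P? Q? P⇒Q xs) (m≤n+m _ (f x i))
  ... | yes px | no ¬qx with 1 ≤? f x i
  ...   | yes i∣fx = ⊥-elim (¬qx (P⇒Q x i∣fx px))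
  ...   | no i∤fx = subst (_≤ prod (map f (filter Q? xs)) i)
                       (cong (_+ prod (map f (filter P? xs)) i) (sym (n<1⇒n≡0 (≰⇒> i∤fx))))
                       (prod-filter-mono P? Q? P⇒Q xs)

  prod-filter-≡0 : ∀ {p} {P : Pred A p} (P? : Decidable₁ P) →
    (∀ x → VarDivides i (f x) → ¬ P x) → ∀ xs → prod (map f (filter P? xs)) i ≡ 0
  prod-filter-≡0 P? ¬P [] = refl
  prod-filter-≡0 P? ¬P (x ∷ xs) with P? x
  ... | no _ = prod-filter-≡0 P? ¬P xs
  ... | yes px with 1 ≤? f x i
  ...   | yes i∣fx = ⊥-elim (¬P x i∣fx px)
  ...   | no i∤fx = cong₂ _+_ (n<1⇒n≡0 (≰⇒> i∤fx)) (prod-filter-≡0 P? ¬P xs)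

module _ {k : ℕ} (i : Fin k) where

  gcdL-glb : ∀ {n y₀} {ys : List (Monomial k)} → y₀ ∈ ys →
    (∀ {y} → y ∈ ys → n ≤ y i) → n ≤ gcdL ys i
  gcdL-glb {ys = y ∷ []} _ lb = lb (here refl)
  gcdL-glb {ys = y ∷ ys@(_ ∷ _)} _ lb = ⊓-glb (lb (here refl)) (gcdL-glb (here refl) (lb ∘ there))

  ∈⇒≤lcmL : ∀ {y ys} → y ∈ ys → y i ≤ lcmL ys i
  ∈⇒≤lcmL {ys = y ∷ ys} (here refl) = m≤m⊔n (y i) (lcmL ys i)
  ∈⇒≤lcmL {ys = z ∷ ys} (there y∈ys) = ≤-trans (∈⇒≤lcmL y∈ys) (m≤n⊔m (z i) (lcmL ys i))

∈-allSubsets : ∀ n (v : Vec Bool n) → v ∈ allSubsets n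
∈-allSubsets _ [] = here refl
∈-allSubsets _ (true ∷ v) = ∈-++⁺ˡ (∈-map⁺ (true ∷_) (∈-allSubsets _ v))
∈-allSubsets _ (false ∷ v) = ∈-++⁺ʳ _ (∈-map⁺ (false ∷_) (∈-allSubsets _ v))

module _ {a ℓ : Level} {A : Set a} {_≤_ : Rel A ℓ} (≤-refl : Reflexive _≤_) (≤-trans : Transitive _≤_) where

  chain-maximum : ∀ xs → (∀ {p q} → p ∈ xs → q ∈ xs → p ≤ q ⊎ q ≤ p) →
    xs ≡ [] ⊎ ∃[ c ] c ∈ xs × (∀ {p} → p ∈ xs → p ≤ c)
  chain-maximum [] _ = inj₁ refl
  chain-maximum (x ∷ xs) comparable with chain-maximum xs (λ p∈ q∈ → comparable (there p∈) (there q∈))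
  ... | inj₁ refl = inj₂ (x , here refl , λ { (here refl) → ≤-refl })
  ... | inj₂ (c , c∈xs , max) with comparable (here refl) (there c∈xs)
  ...   | inj₁ x≤c = inj₂ (c , there c∈xs , λ { (here refl) → x≤c ; (there p∈) → max p∈ })
  ...   | inj₂ c≤x = inj₂ (x , here refl , λ { (here refl) → ≤-refl ; (there p∈) → ≤-trans (max p∈) c≤x })

module _ (L : FiniteLattice) where
  open FiniteLattice L
  open IsLattice isLattice using (x≤x∨y; y≤x∨y; ∨-least) renaming (trans to ≼-trans)

  private
    ⋁-over : Subset → List Elt → Elt
    ⋁-over T = foldr (λ i acc → if lookup T i then i ∨ acc else acc) 𝟘

    ≤-⋁-over : ∀ {b} T xs → b ∈ xs → b ∈ₛ T → b ≼ ⋁-over T xs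
    ≤-⋁-over T (b ∷ xs) (here refl) b∈T rewrite b∈T = x≤x∨y b _
    ≤-⋁-over T (i ∷ xs) (there b∈xs) b∈T with lookup T i
    ... | true = ≼-trans (≤-⋁-over T xs b∈xs b∈T) (y≤x∨y i _)
    ... | false = ≤-⋁-over T xs b∈xs b∈T

    ⋁-over⋠⇒∃⋠ : ∀ T {c} xs → ¬ ⋁-over T xs ≼ c → ∃[ b ] b ∈ₛ T × ¬ b ≼ c
    ⋁-over⋠⇒∃⋠ T {c} [] ⋁⋠c = ⊥-elim (⋁⋠c (𝟘-least c))
    ⋁-over⋠⇒∃⋠ T {c} (i ∷ xs) ⋁⋠c with lookup T i in i∈T
    ... | false = ⋁-over⋠⇒∃⋠ T xs ⋁⋠c
    ... | true with i ≼? c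
    ...   | no i⋠c = i , i∈T , i⋠c
    ...   | yes i≼c = ⋁-over⋠⇒∃⋠ T xs (⋁⋠c ∘ ∨-least i≼c)

  ≤-⋁ : ∀ {b} T → b ∈ₛ T → b ≼ ⋁ T
  ≤-⋁ {b} T = ≤-⋁-over T (allFin size) (∈-allFin b)

  ⋁⋠⇒∃⋠ : ∀ T {c} → ¬ ⋁ T ≼ c → ∃[ b ] b ∈ₛ T × ¬ b ≼ c
  ⋁⋠⇒∃⋠ T = ⋁-over⋠⇒∃⋠ T (allFin size)

module _ (P : FiniteAtomicLattice) where
  open FiniteAtomicLattice P

  ∈-upperB⁻ : ∀ {a T} → T ∈ upperB a → ∃[ q ] a ≼ q × InB q T
  ∈-upperB⁻ {a} T∈ with find (∈-concatMap⁻ (λ q → filter (inB? q) (allSubsets size))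
                                            {xs = filter (a ≼?_) (allFin size)} T∈)
  ... | q , q∈ , T∈Bq = q , proj₂ (∈-filter⁻ (a ≼?_) {xs = allFin size} q∈)
                          , proj₂ (∈-filter⁻ (inB? q) {xs = allSubsets size} T∈Bq)

  ∈-upperB⁺ : ∀ {a q} T → a ≼ q → InB q T → T ∈ upperB a
  ∈-upperB⁺ {a} {q} T a≼q T∈Bq =
    ∈-concatMap⁺ (λ q → filter (inB? q) (allSubsets size))
      (lose (∈-filter⁺ (a ≼?_) (∈-allFin q) a≼q) (∈-filter⁺ (inB? q) (∈-allSubsets size T) T∈Bq))

  nonzero⇒∃InB : ∀ {a} → a ≢ 𝟘 → ∃[ T ] InB a T
  nonzero⇒∃InB {a} a≢𝟘 with atomic a a≢𝟘
  ... | T , atoms-T , ⋁T≡a = T , (λ b b∈T → atoms-T b b∈T , subst (b ≼_) ⋁T≡a (≤-⋁ lattice T b∈T)) , ⋁T≡a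

  ∈-members⁺ : ∀ {b} T → b ∈ₛ T → b ∈ members T
  ∈-members⁺ {b} T = ∈-filter⁺ (λ i → lookup T i ≟ true) (∈-allFin b)

module _ (P : FiniteAtomicLattice) {k : ℕ} (m : Labeling P k) (x₀ : Fin k) where
  open FiniteAtomicLattice P
  open IsLattice isLattice using () renaming (refl to ≼-refl; trans to ≼-trans)

  Marked : Elt → Set
  Marked p = VarDivides x₀ (m p)

  MarkedOutside : Elt → Elt → Set
  MarkedOutside a p = ¬ a ≼ p × Marked p

  markedOutside : Elt → List Elt
  markedOutside a = filter (λ p → ¬? (a ≼? p) ×-dec (1 ≤? m p x₀)) (allFin size)

  xLab-exponent-mono : ∀ {a b} → (∀ p → Marked p → ¬ a ≼ p → ¬ b ≼ p) →
    xLab P m a x₀ ≤ xLab P m b x₀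
  xLab-exponent-mono {a} {b} outside =
    prod-filter-mono m x₀ (λ p → ¬? (a ≼? p)) (λ p → ¬? (b ≼? p)) outside (allFin size)

  xLab-exponent-≡0 : ∀ {a} → ∄[ p ] MarkedOutside a p → xLab P m a x₀ ≡ 0
  xLab-exponent-≡0 {a} none =
    prod-filter-≡0 m x₀ (λ p → ¬? (a ≼? p)) (λ p x₀∣mp a⋠p → none (p , a⋠p , x₀∣mp)) (allFin size)

  xLab≤triangle : ∀ {a c} → a ≢ 𝟘 → ¬ a ≼ c → (∀ p → MarkedOutside a p → p ≼ c) →
    xLab P m a x₀ ≤ triangle P m a x₀
  xLab≤triangle {a} {c} a≢𝟘 a⋠c below-c =
    gcdL-glb x₀ (∈-map⁺ lcmX (∈-upperB⁺ P T₀ ≼-refl T₀∈Bₐ)) bound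
    where
    T₀ : Subset
    T₀ = proj₁ (nonzero⇒∃InB P a≢𝟘)

    T₀∈Bₐ : InB a T₀
    T₀∈Bₐ = proj₂ (nonzero⇒∃InB P a≢𝟘)

    lcmX : Subset → Monomial k
    lcmX T = lcmL (map (xLab P m) (members T))

    bound : ∀ {y} → y ∈ map lcmX (upperB a) → xLab P m a x₀ ≤ y x₀
    bound y∈ with ∈-map⁻ lcmX y∈
    ... | T , T∈ , refl with ∈-upperB⁻ P T∈
    ...   | q , a≼q , _ , ⋁T≡q with ⋁⋠⇒∃⋠ lattice T (λ ⋁T≼c → a⋠c (≼-trans a≼q (subst (_≼ c) ⋁T≡q ⋁T≼c)))
    ...     | b , b∈T , b⋠c =
      ≤-trans (xLab-exponent-mono (λ p x₀∣mp a⋠p b≼p → b⋠c (≼-trans b≼p (below-c p (a⋠p , x₀∣mp)))))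
              (∈⇒≤lcmL x₀ (∈-map⁺ (xLab P m) (∈-members⁺ P T b∈T)))

  ∈-markedOutside⁺ : ∀ {a p} → MarkedOutside a p → p ∈ markedOutside a
  ∈-markedOutside⁺ {p = p} = ∈-filter⁺ _ (∈-allFin p)

  ∈-markedOutside⁻ : ∀ {a p} → p ∈ markedOutside a → MarkedOutside a p
  ∈-markedOutside⁻ = proj₂ ∘ ∈-filter⁻ _ {xs = allFin size}

  marked-chain⇒xLab≤triangle : (∀ p q → Marked p → Marked q → p ≼ q ⊎ q ≼ p) →
    ∀ {a} → a ≢ 𝟘 → xLab P m a x₀ ≤ triangle P m a x₀
  marked-chain⇒xLab≤triangle chain {a} a≢𝟘
    with chain-maximum ≼-refl ≼-trans (markedOutside a)
           (λ p∈ q∈ → chain _ _ (proj₂ (∈-markedOutside⁻ p∈)) (proj₂ (∈-markedOutside⁻ q∈)))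
  ... | inj₁ empty = subst (_≤ triangle P m a x₀) (sym (xLab-exponent-≡0 none)) z≤n
    where
    none : ∄[ p ] MarkedOutside a p
    none (p , p-out) with subst (p ∈_) empty (∈-markedOutside⁺ p-out)
    ... | ()
  ... | inj₂ (c , c∈ , max) =
    xLab≤triangle a≢𝟘 (proj₁ (∈-markedOutside⁻ c∈)) (λ p p-out → max (∈-markedOutside⁺ p-out))

lemma3p3 : (P : FiniteAtomicLattice) (k : ℕ) (m : Labeling P k) (x₀ : Fin k) →
    (∀ p q → VarDivides x₀ (m p) → VarDivides x₀ (m q) →
    FiniteAtomicLattice._≼_ P p q ⊎ FiniteAtomicLattice._≼_ P q p) →
    ∀ a → FiniteAtomicLattice.IsAtom P a →
    ¬ VarDivides x₀ (xLab P m a ÷ gcd₂ (triangle P m a) (xLab P m a))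
lemma3p3 P k m x₀ chain a (a≢𝟘 , _) x₀∣quotient
  with subst (1 ≤_) (n≤m⇒n∸m⊓n≡0 (marked-chain⇒xLab≤triangle P m x₀ chain a≢𝟘)) x₀∣quotient
... | ()
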